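{- Let $n>1$ and $D>0$. Suppose that $K \subseteq \{0,1\}^n$ satisfies $|K| > 2^{n-1}$ and that every $y \in K$ has degree at most $D$ in the induced subgraph $H_n[K]$ of the $n$-dimensional Boolean hypercube $H_n$. Then $\mathrm{compl}(\mathcal{G}_{CS,n}) \le D$.
   Context: $H_n$ is the graph on $\{0,1\}^n$ in which two strings are adjacent iff they differ in exactly one coordinate; $H_n[K]$ is the induced subgraph on vertex set $K$. Let $S_n$ be the set of permutations $\pi=(\pi(1),\dots,\pi(n))$ of $[n]$. A Bob-strategy $\mathrm{STRAT}_B$ is a family of functions $F_t: S_n \to \{0,1\}$, $t=1,\dots,n-1$, where each $F_t$ is $t$-restricted, i.e. $F_t(\pi)$ depends only on $\pi(1),\dots,\pi(t)$. For such a strategy, $\pi\in S_n$ and $z\in\{0,1\}$, define $b(\pi,z)\in\{0,1\}^n$ by $b_j = F_t(\pi)$ if $j=\pi(t)$ for some $t<n$, and $b_j = z$ if $j=\pi(n)$. For $b\in\{0,1\}^n$, let $S(b) := \{ i \in [n] : \exists \rho\in S_n, u\in\{0,1\} \text{ with } \rho(n)=i \text{ and } b(\rho,u)=b\}$. The cost of $\mathrm{STRAT}_B$ on $(\pi,z)$ is $|S(b(\pi,z))|$, the complexity $\mathrm{compl}(\mathrm{STRAT}_B)$ is the maximum cost over all pairs $(\pi,z)\in S_n\times\{0,1\}$, and $\mathrm{compl}(\mathcal{G}_{CS,n})$ is the minimum of $\mathrm{compl}(\mathrm{STRAT}_B)$ over all Bob-strategies for $n$. -}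

module Defs where

open import Data.Nat using (ℕ; zero; suc; _≤_; _<_; _<ᵇ_)
open import Data.Bool using (Bool; true; false; not; if_then_else_)
open import Data.Fin using (Fin; toℕ)
open import Data.Vec using (Vec; []; _∷_; _[_]%=_)
open import Data.List using (List; []; _∷_; _++_; map; length; filterᵇ; allFin)
open import Data.List.Relation.Unary.All using (All)
open import Data.List.Relation.Unary.Unique.Propositional using (Unique)
open import Data.Fin.Permutation using (Permutation′; _⟨$⟩ʳ_; _⟨$⟩ˡ_)
open import Data.Product using (Σ; ∃; _×_; _,_)
open import Relation.Binary.PropositionalEquality using (_≡_)

Cube : ℕ → Set
Cube n = Vec Bool n

allCube : (n : ℕ) → List (Cube n)
allCube zero    = [] ∷ []
allCube (suc n) = map (false ∷_) (allCube n) ++ map (true ∷_) (allCube n)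

size : {n : ℕ} → (Cube n → Bool) → ℕ
size {n} K = length (filterᵇ K (allCube n))

flip : {n : ℕ} → Cube n → Fin n → Cube n
flip y i = y [ i ]%= not

degree : {n : ℕ} → (Cube n → Bool) → Cube n → ℕ
degree {n} K y = length (filterᵇ (λ i → K (flip y i)) (allFin n))

-- S_n : permutations of [n]; π(t) (1-based t) is  π ⟨$⟩ʳ s  with s the 0-based position t-1.
Perm : ℕ → Set
Perm n = Permutation′ n

-- F_t (for 1 ≤ t ≤ n-1) is t-restricted: depends only on π(1),…,π(t),
-- i.e. on the values of π at 0-based positions s < t.
Restricted : {n : ℕ} → ℕ → (Perm n → Bool) → Set
Restricted {n} t f =
  (π σ : Perm n) → ((s : Fin n) → toℕ s < t → π ⟨$⟩ʳ s ≡ σ ⟨$⟩ʳ s) → f π ≡ f σ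

-- A Bob-strategy: a family F_t (indexed by ℕ; only 1 ≤ t ≤ n-1 is used),
-- each F_t being t-restricted.
BobStrategy : ℕ → Set
BobStrategy n =
  Σ (ℕ → Perm n → Bool) λ F → (t : ℕ) → 1 ≤ t → t < n → Restricted t (F t)

-- b(π,z): coordinate j = π(t) gets F_t(π) if t < n, and z if t = n.
-- Here t = 1 + (0-based position of j in π) = 1 + toℕ (π⁻¹ j).
bvec : {n : ℕ} → BobStrategy n → Perm n → Bool → Fin n → Bool
bvec {n} (F , _) π z j =
  if suc (toℕ (π ⟨$⟩ˡ j)) <ᵇ n then F (suc (toℕ (π ⟨$⟩ˡ j))) π else z

InS : {n : ℕ} → BobStrategy n → (Fin n → Bool) → Fin n → Set
InS {n} st b i =
  Σ (Perm n) λ ρ → Σ Bool λ u →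
    (suc (toℕ (ρ ⟨$⟩ˡ i)) ≡ n) × ((j : Fin n) → bvec st ρ u j ≡ b j)

CardAtMost : {n : ℕ} → (Fin n → Set) → ℕ → Set
CardAtMost {n} P D = (L : List (Fin n)) → Unique L → All P L → length L ≤ D

ComplAtMost : {n : ℕ} → BobStrategy n → ℕ → Set
ComplAtMost {n} st D = (π : Perm n) (z : Bool) → CardAtMost (InS st (bvec st π z)) D

GameComplAtMost : ℕ → ℕ → Set
GameComplAtMost n D = Σ (BobStrategy n) λ st → ComplAtMost st D

-- Bob keeps a subcube Q of the hypercube, initially the whole cube. When the coordinate
-- π(t) is revealed he fixes it to the value whose half of Q contains more points of K, so
-- K stays strictly denser than 1/2 in Q. After n - 1 moves Q is the edge through
-- b = b(π,z) in direction π(n), and density > 1/2 forces both endpoints into K. Every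
-- i ∈ S(b) arises this way from some play ρ with ρ(n) = i, so b and its neighbour in
-- direction i both lie in K: S(b) is contained in the neighbourhood of b in H_n[K].
module Submission where

open import Algebra.Properties.CommutativeSemigroup using (interchange)
open import Data.Bool using (Bool; true; false; if_then_else_)
open import Data.Bool.Properties using (T?; T-≡)
open import Data.Empty using (⊥-elim)
open import Data.Fin using (Fin; toℕ) renaming (zero to fzero; suc to fsuc)
import Data.Fin.Properties as Fin
open import Data.Fin.Permutation using (_⟨$⟩ʳ_; _⟨$⟩ˡ_; inverseˡ; inverseʳ)
open import Data.List using (List; []; _∷_; _++_; map; length; filterᵇ; allFin)
open import Data.List.Properties using (length-++; filter-++)
open import Data.List.Membership.Propositional using (_∈_)
open import Data.List.Membership.Propositional.Properties using (∈-filter⁺; ∈-allFin)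
open import Data.List.Relation.Binary.Subset.Propositional using (_⊆_)
open import Data.List.Relation.Unary.All as All using (All; []; _∷_)
open import Data.List.Relation.Unary.AllPairs using ([]; _∷_)
open import Data.List.Relation.Unary.Any using (here; there)
open import Data.List.Relation.Unary.Unique.Propositional using (Unique)
open import Data.Maybe using (Maybe; just; nothing)
open import Data.Maybe.Properties using (just-injective)
open import Data.Nat using (ℕ; zero; suc; pred; _+_; _*_; _^_; _∸_; _≤_; _<_; _<ᵇ_; _≤?_; _<?_; z≤n; s≤s; NonZero)
open import Data.Nat.DivMod using (_mod_; m<n⇒m%n≡m; m%n≤m)
open import Data.Nat.Properties
open import Data.Product using (∃-syntax; _×_; _,_; proj₁; proj₂)
open import Data.Sum using (inj₁; inj₂)
open import Data.Vec using (Vec; []; _∷_; lookup; replicate; tabulate; _[_]≔_)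
open import Data.Vec.Properties using (lookup∘update; lookup∘update′; lookup∘updateAt′; lookup-replicate; lookup∘tabulate; tabulate-cong)
open import Function using (_∘_; Equivalence)
open import Relation.Binary.PropositionalEquality
open import Relation.Nullary using (Dec; yes; no; contradiction)
open import Relation.Nullary.Decidable using (⌊_⌋)

open import Defs

module _ {A : Set} where

  remove : ∀ {x : A} {M} → x ∈ M →
    ∃[ M′ ] length M ≡ suc (length M′) × (∀ {y} → y ∈ M → x ≢ y → y ∈ M′)
  remove {M = _ ∷ M} (here refl) = M , refl , λ where
    (here refl) x≢x → ⊥-elim (x≢x refl)
    (there y∈M) _   → y∈M
  remove {M = z ∷ _} (there x∈M) with remove x∈M
  ... | M′ , |M|≡ , ⊆M′ = z ∷ M′ , cong suc |M|≡ , λ where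
    (here refl) _   → here refl
    (there y∈M) x≢y → there (⊆M′ y∈M x≢y)

  unique∧⊆⇒length≤ : ∀ {L M : List A} → Unique L → L ⊆ M → length L ≤ length M
  unique∧⊆⇒length≤ {[]}    _              _   = z≤n
  unique∧⊆⇒length≤ {x ∷ L} (x≢L ∷ uniqueL) L⊆M with remove (L⊆M (here refl))
  ... | M′ , |M|≡ , ⊆M′ =
    ≤-trans (s≤s (unique∧⊆⇒length≤ uniqueL L⊆M′)) (≤-reflexive (sym |M|≡))
    where
    L⊆M′ : L ⊆ M′
    L⊆M′ y∈L = ⊆M′ (L⊆M (there y∈L)) (All.lookup x≢L y∈L)

toℕ-mod : ∀ {k n} .{{_ : NonZero n}} → k < n → toℕ (k mod n) ≡ k
toℕ-mod k<n = trans (Fin.toℕ-fromℕ< _) (m<n⇒m%n≡m k<n)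

toℕ-mod≤ : ∀ k n .{{_ : NonZero n}} → toℕ (k mod n) ≤ k
toℕ-mod≤ k n = ≤-trans (≤-reflexive (Fin.toℕ-fromℕ< _)) (m%n≤m k n)

length-filterᵇ-map : ∀ {A B : Set} (p : B → Bool) (f : A → B) (xs : List A) →
  length (filterᵇ p (map f xs)) ≡ length (filterᵇ (p ∘ f) xs)
length-filterᵇ-map p f []       = refl
length-filterᵇ-map p f (x ∷ xs) with p (f x)
... | true  = cong suc (length-filterᵇ-map p f xs)
... | false = length-filterᵇ-map p f xs

majority : (Bool → ℕ) → Bool
majority f = ⌊ f false ≤? f true ⌋

majority-bound : ∀ (f : Bool → ℕ) → f false + f true ≤ 2 * f (majority f)
majority-bound f = bound (f false ≤? f true)
  where
  bound : (d : Dec (f false ≤ f true)) → f false + f true ≤ 2 * f ⌊ d ⌋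
  bound (yes f₀≤f₁) = begin
    f false + f true ≤⟨ +-monoˡ-≤ (f true) f₀≤f₁ ⟩
    f true + f true  ≡⟨ cong (f true +_) (sym (+-identityʳ (f true))) ⟩
    2 * f true       ∎
    where open ≤-Reasoning
  bound (no f₀≰f₁) = begin
    f false + f true  ≤⟨ +-monoʳ-≤ (f false) (≰⇒≥ f₀≰f₁) ⟩
    f false + f false ≡⟨ cong (f false +_) (sym (+-identityʳ (f false))) ⟩
    2 * f false       ∎
    where open ≤-Reasoning

-- A partial assignment; nothing marks a free coordinate.
Subcube : ℕ → Set
Subcube n = Vec (Maybe Bool) n

whole : (n : ℕ) → Subcube n
whole n = replicate n nothing

fix : ∀ {n} → Subcube n → Fin n → Bool → Subcube n
fix Q i b = Q [ i ]≔ just b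

dim : ∀ {n} → Subcube n → ℕ
dim []            = 0
dim (nothing ∷ Q) = suc (dim Q)
dim (just _ ∷ Q)  = dim Q

count : ∀ {n} → Subcube n → (Cube n → Bool) → ℕ
count []            K = if K [] then 1 else 0
count (nothing ∷ Q) K = count Q (K ∘ (false ∷_)) + count Q (K ∘ (true ∷_))
count (just b ∷ Q)  K = count Q (K ∘ (b ∷_))

_∈ᶜ_ : ∀ {n} → Cube n → Subcube n → Set
y ∈ᶜ Q = ∀ j {b} → lookup Q j ≡ just b → lookup y j ≡ b

Dense : ∀ {n} → (Cube n → Bool) → Subcube n → Set
Dense K Q = 2 ^ dim Q < 2 * count Q K

dim-whole : ∀ n → dim (whole n) ≡ n
dim-whole zero    = refl
dim-whole (suc n) = cong suc (dim-whole n)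

count-whole : ∀ n (K : Cube n → Bool) → count (whole n) K ≡ size K
count-whole zero K with K []
... | true  = refl
... | false = refl
count-whole (suc n) K = begin
  count (whole n) (K ∘ (false ∷_)) + count (whole n) (K ∘ (true ∷_))
    ≡⟨ cong₂ _+_ (count-whole n _) (count-whole n _) ⟩
  length (filterᵇ (K ∘ (false ∷_)) A) + length (filterᵇ (K ∘ (true ∷_)) A)
    ≡⟨ sym (cong₂ _+_ (length-filterᵇ-map K (false ∷_) A) (length-filterᵇ-map K (true ∷_) A)) ⟩
  length (filterᵇ K A₀) + length (filterᵇ K A₁)
    ≡⟨ sym (length-++ (filterᵇ K A₀)) ⟩
  length (filterᵇ K A₀ ++ filterᵇ K A₁)
    ≡⟨ cong length (sym (filter-++ (T? ∘ K) A₀ A₁)) ⟩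
  size K ∎
  where
  open ≡-Reasoning
  A  = allCube n
  A₀ = map (false ∷_) A
  A₁ = map (true ∷_) A

dim-fix : ∀ {n} (Q : Subcube n) i b → lookup Q i ≡ nothing → dim Q ≡ suc (dim (fix Q i b))
dim-fix (nothing ∷ Q) fzero    b _    = refl
dim-fix (nothing ∷ Q) (fsuc i) b free = cong suc (dim-fix Q i b free)
dim-fix (just _ ∷ Q)  (fsuc i) b free = dim-fix Q i b free

count-fix : ∀ {n} (Q : Subcube n) i K → lookup Q i ≡ nothing →
  count Q K ≡ count (fix Q i false) K + count (fix Q i true) K
count-fix (nothing ∷ Q) fzero    K _    = refl
count-fix (nothing ∷ Q) (fsuc i) K free =
  trans (cong₂ _+_ (count-fix Q i _ free) (count-fix Q i _ free))
        (interchange +-commutativeSemigroup (c false false) (c true false) (c false true) (c true true))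
  where
  c : Bool → Bool → ℕ
  c b a = count (fix Q i b) (K ∘ (a ∷_))
count-fix (just _ ∷ Q)  (fsuc i) K free = count-fix Q i _ free

count≤2^dim : ∀ {n} (Q : Subcube n) K → count Q K ≤ 2 ^ dim Q
count≤2^dim [] K with K []
... | true  = ≤-refl
... | false = z≤n
count≤2^dim (nothing ∷ Q) K = +-mono-≤ (count≤2^dim Q _) (≤-trans (count≤2^dim Q _) (m≤m+n _ 0))
count≤2^dim (just _ ∷ Q)  K = count≤2^dim Q _

count<2^dim : ∀ {n} (Q : Subcube n) K {y} → K y ≡ false → y ∈ᶜ Q → count Q K < 2 ^ dim Q
count<2^dim [] K {[]} Ky≡false _ rewrite Ky≡false = s≤s z≤n
count<2^dim (nothing ∷ Q) K {false ∷ y} Ky≡false y∈Q =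
  +-mono-<-≤ (count<2^dim Q _ Ky≡false (y∈Q ∘ fsuc)) (≤-trans (count≤2^dim Q _) (m≤m+n _ 0))
count<2^dim (nothing ∷ Q) K {true ∷ y} Ky≡false y∈Q =
  +-mono-≤-< (count≤2^dim Q _) (<-≤-trans (count<2^dim Q _ Ky≡false (y∈Q ∘ fsuc)) (m≤m+n _ 0))
count<2^dim (just b ∷ Q) K {a ∷ y} Ky≡false y∈Q with y∈Q fzero refl
... | refl = count<2^dim Q _ Ky≡false (y∈Q ∘ fsuc)

dense-edge⇒⊆ : ∀ {n} (Q : Subcube n) K {y} → dim Q ≡ 1 → Dense K Q → y ∈ᶜ Q → K y ≡ true
dense-edge⇒⊆ Q K {y} dimQ≡1 dense y∈Q with K y in Ky
... | true  = refl
... | false = contradiction (*-cancelˡ-< 2 1 (count Q K) 2<2*count)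
                            (<⇒≱ (subst (λ d → count Q K < 2 ^ d) dimQ≡1 (count<2^dim Q K Ky y∈Q)))
  where
  2<2*count : 2 < 2 * count Q K
  2<2*count = subst (λ d → 2 ^ d < 2 * count Q K) dimQ≡1 dense

∈ᶜ-flip : ∀ {n} (Q : Subcube n) y i → lookup Q i ≡ nothing → y ∈ᶜ Q → flip y i ∈ᶜ Q
∈ᶜ-flip Q y i free y∈Q j Qj≡b = trans (lookup∘updateAt′ j i j≢i y) (y∈Q j Qj≡b)
  where
  j≢i : j ≢ i
  j≢i j≡i with trans (sym Qj≡b) (trans (cong (lookup Q) j≡i) free)
  ... | ()

greedyChoice : ∀ {n} → (Cube n → Bool) → Subcube n → Fin n → Bool
greedyChoice K Q i = majority λ b → count (fix Q i b) K

greedy : ∀ {n} → (Cube n → Bool) → Subcube n → Fin n → Subcube n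
greedy K Q i = fix Q i (greedyChoice K Q i)

greedy-dense : ∀ {n} (K : Cube n → Bool) Q i → lookup Q i ≡ nothing →
  Dense K Q → Dense K (greedy K Q i)
greedy-dense K Q i free dense = *-cancelˡ-< 2 _ _ (begin-strict
  2 * 2 ^ dim (greedy K Q i) ≡⟨ cong (2 ^_) (sym (dim-fix Q i _ free)) ⟩
  2 ^ dim Q                  <⟨ dense ⟩
  2 * count Q K              ≡⟨ cong (2 *_) (count-fix Q i K free) ⟩
  2 * (c false + c true)     ≤⟨ *-monoʳ-≤ 2 (majority-bound c) ⟩
  2 * (2 * count (greedy K Q i) K) ∎)
  where
  open ≤-Reasoning
  c : Bool → ℕ
  c b = count (fix Q i b) K

size>half⇒dense : ∀ {m} (K : Cube (suc m) → Bool) → 2 ^ m < size K → Dense K (whole (suc m))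
size>half⇒dense {m} K half<size =
  subst₂ (λ d c → 2 ^ d < 2 * c) (sym (dim-whole (suc m))) (sym (count-whole (suc m) K))
    (*-monoʳ-< 2 half<size)

module Play {m : ℕ} (K : Cube (suc m) → Bool) where

  private
    n : ℕ
    n = suc m

  -- For k ≥ n the index wraps around; only k < n is ever used.
  revealed : Perm n → ℕ → Fin n
  revealed π k = π ⟨$⟩ʳ (k mod n)

  position : Perm n → Fin n → ℕ
  position π j = toℕ (π ⟨$⟩ˡ j)

  position-revealed : ∀ π {k} → k < n → position π (revealed π k) ≡ k
  position-revealed π k<n = trans (cong toℕ (inverseˡ π)) (toℕ-mod k<n)

  revealed-position : ∀ π j → revealed π (position π j) ≡ j
  revealed-position π j =
    trans (cong (π ⟨$⟩ʳ_) (Fin.toℕ-injective (toℕ-mod (Fin.toℕ<n (π ⟨$⟩ˡ j))))) (inverseʳ π)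

  run : Perm n → ℕ → Subcube n
  run π zero    = whole n
  run π (suc k) = greedy K (run π k) (revealed π k)

  move : Perm n → ℕ → Bool
  move π k = greedyChoice K (run π k) (revealed π k)

  run-hidden : ∀ π {j k} → k ≤ position π j → lookup (run π k) j ≡ nothing
  run-hidden π {j} {zero}  _   = lookup-replicate j nothing
  run-hidden π {j} {suc k} k<p =
    trans (lookup∘update′ j≢revealed (run π k) _) (run-hidden π (<⇒≤ k<p))
    where
    j≢revealed : j ≢ revealed π k
    j≢revealed eq = <-irrefl
      (trans (sym (position-revealed π (<-trans k<p (Fin.toℕ<n _)))) (cong (position π) (sym eq))) k<p

  run-revealed : ∀ π {j k} → position π j < k → k ≤ n →
    lookup (run π k) j ≡ just (move π (position π j))
  run-revealed π {j} {suc k} p<1+k k<n with m<1+n⇒m<n∨m≡n p<1+k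
  ... | inj₁ p<k = trans (lookup∘update′ j≢revealed (run π k) _) (run-revealed π p<k (<⇒≤ k<n))
    where
    j≢revealed : j ≢ revealed π k
    j≢revealed eq = <-irrefl (trans (cong (position π) eq) (position-revealed π k<n)) p<k
  ... | inj₂ refl =
    subst (λ i → lookup (run π (suc (position π j))) i ≡ just (move π (position π j)))
      (revealed-position π j) (lookup∘update (revealed π (position π j)) (run π (position π j)) _)

  revealed-fresh : ∀ π {k} → k < n → lookup (run π k) (revealed π k) ≡ nothing
  revealed-fresh π k<n = run-hidden π (≤-reflexive (sym (position-revealed π k<n)))

  dim-run : ∀ π {k} → k ≤ n → dim (run π k) + k ≡ n
  dim-run π {zero}  _   = trans (+-identityʳ _) (dim-whole n)
  dim-run π {suc k} k<n = begin
    dim (run π (suc k)) + suc k   ≡⟨ +-suc _ k ⟩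
    suc (dim (run π (suc k))) + k ≡⟨ cong (_+ k) (sym (dim-fix (run π k) _ _ (revealed-fresh π k<n))) ⟩
    dim (run π k) + k             ≡⟨ dim-run π (<⇒≤ k<n) ⟩
    n                             ∎
    where open ≡-Reasoning

  run-dense : Dense K (whole n) → ∀ π {k} → k ≤ n → Dense K (run π k)
  run-dense dense π {zero}  _   = dense
  run-dense dense π {suc k} k<n =
    greedy-dense K (run π k) (revealed π k) (revealed-fresh π k<n) (run-dense dense π (<⇒≤ k<n))

  module _ (π σ : Perm n) {t} (agree : ∀ s → toℕ s < t → π ⟨$⟩ʳ s ≡ σ ⟨$⟩ʳ s) where

    revealed-agree : ∀ {k} → k < t → revealed π k ≡ revealed σ k
    revealed-agree {k} k<t = agree _ (≤-<-trans (toℕ-mod≤ k n) k<t)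

    run-agree : ∀ {k} → k ≤ t → run π k ≡ run σ k
    run-agree {zero}  _   = refl
    run-agree {suc k} k<t = cong₂ (greedy K) (run-agree (<⇒≤ k<t)) (revealed-agree k<t)

  -- F_t is the move made after seeing π(1), …, π(t), i.e. at 0-based step t - 1.
  strategy : BobStrategy n
  strategy = (λ t π → move π (pred t)) , restricted
    where
    restricted : ∀ t → 1 ≤ t → t < n → Restricted t (λ π → move π (pred t))
    restricted (suc t) _ _ π σ agree =
      cong₂ (greedyChoice K) (run-agree π σ agree (n≤1+n t)) (revealed-agree π σ agree (n<1+n t))

  bvec-revealed : ∀ π z {j} → position π j < m → bvec strategy π z j ≡ move π (position π j)
  bvec-revealed π z {j} p<m with position π j <ᵇ m | <⇒<ᵇ p<m
  ... | true | _ = refl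

  bvec∈run : ∀ π z → tabulate (bvec strategy π z) ∈ᶜ run π m
  bvec∈run π z j {v} Qj≡v with position π j <? m
  ... | yes p<m = begin
    lookup (tabulate (bvec strategy π z)) j ≡⟨ lookup∘tabulate (bvec strategy π z) j ⟩
    bvec strategy π z j                     ≡⟨ bvec-revealed π z p<m ⟩
    move π (position π j)                   ≡⟨ just-injective (trans (sym (run-revealed π p<m (n≤1+n m))) Qj≡v) ⟩
    v                                       ∎
    where open ≡-Reasoning
  ... | no p≮m = contradiction (trans (sym Qj≡v) (run-hidden π (≮⇒≥ p≮m))) λ ()

  InS⇒edge⊆K : Dense K (whole n) → ∀ {b i} → InS strategy b i →
    K (tabulate b) ≡ true × K (flip (tabulate b) i) ≡ true
  InS⇒edge⊆K dense {b} {i} (ρ , u , last , bvec≗b) =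
    dense-edge⇒⊆ Q K dim≡1 denseQ y∈Q ,
    dense-edge⇒⊆ Q K dim≡1 denseQ (∈ᶜ-flip Q (tabulate b) i i-free y∈Q)
    where
    Q : Subcube n
    Q = run ρ m
    dim≡1 : dim Q ≡ 1
    dim≡1 = +-cancelʳ-≡ m (dim Q) 1 (dim-run ρ (n≤1+n m))
    denseQ : Dense K Q
    denseQ = run-dense dense ρ (n≤1+n m)
    y∈Q : tabulate b ∈ᶜ Q
    y∈Q = subst (_∈ᶜ Q) (tabulate-cong bvec≗b) (bvec∈run ρ u)
    i-free : lookup Q i ≡ nothing
    i-free = run-hidden ρ (≤-reflexive (sym (suc-injective last)))

  strategy-cost : Dense K (whole n) → ∀ {D} → (∀ y → K y ≡ true → degree K y ≤ D) →
    ComplAtMost strategy D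
  strategy-cost dense deg π z [] _ _ = z≤n
  strategy-cost dense deg π z L@(i ∷ _) uniqueL inS@(i∈S ∷ _) =
    ≤-trans (unique∧⊆⇒length≤ uniqueL L⊆neighbours) (deg y (proj₁ (InS⇒edge⊆K dense i∈S)))
    where
    y : Cube n
    y = tabulate (bvec strategy π z)
    L⊆neighbours : L ⊆ filterᵇ (λ j → K (flip y j)) (allFin n)
    L⊆neighbours x∈L = ∈-filter⁺ (λ j → T? (K (flip y j))) (∈-allFin _)
      (Equivalence.from T-≡ (proj₂ (InS⇒edge⊆K dense (All.lookup inS x∈L))))

theorem1 : (n D : ℕ) → 1 < n → 0 < D → (K : Cube n → Bool) →
    2 ^ (n ∸ 1) < size K →
    ((y : Cube n) → K y ≡ true → degree K y ≤ D) →
    GameComplAtMost n D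
theorem1 zero    D ()
theorem1 (suc m) D _ _ K half<size deg = strategy , strategy-cost (size>half⇒dense K half<size) deg
  where open Play K
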